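{- Let $\Delta$ be an integer with $2 \leq \Delta \leq 27$. If $\Delta$ is even and $G \in \mathcal{G}_{2,\Delta}$, then $GA_1(G) < GA_1(K_{2,\Delta})$. If $\Delta$ is odd, then $GA_1(H_\Delta) < GA_1(K_{2,\Delta})$.
   Context: All graphs are finite, simple (no loops or multiple edges) and have at least one edge. For a vertex $u$, $d_u$ denotes its degree. The geometric-arithmetic index of $G$ is $GA_1(G) = \sum_{uv \in E(G)} \frac{2\sqrt{d_u d_v}}{d_u + d_v}$. $K_{2,\Delta}$ is the complete bipartite graph with parts of sizes $2$ and $\Delta$. For integers $0 < \delta \leq \Delta$, $\mathcal{G}_{\delta,\Delta}$ denotes the set of graphs with minimum degree $\delta$ and maximum degree $\Delta$ such that: (1) if $\delta = \Delta$, $G \cong K_{\Delta+1}$; (2) if $\delta < \Delta$ and $\Delta(\delta+1)$ is even, $|V(G)| = \Delta + 1$ and there are $\Delta$ vertices of degree $\delta$; (3) if $\delta < \Delta - 1$ and $\Delta(\delta+1)$ is odd, $|V(G)| = \Delta+1$, there are $\Delta - 1$ vertices of degree $\delta$ and one vertex of degree $\delta+1$; (4) if $\delta = \Delta - 1$ and $\Delta$ is odd, $|V(G)| = \Delta + 1$, there are $\Delta - 1$ vertices of degree $\delta$ and two vertices of degree $\Delta$. For an odd integer $\Delta \geq 3$, $H_\Delta$ is the graph with $\Delta + 1$ vertices, minimum degree $2$ and maximum degree $\Delta$, having two adjacent vertices $x_0, x_1$ of degree $\Delta$ and $\Delta - 1$ vertices $x_2, \dots, x_\Delta$ of degree $2$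 (each $x_i$, $i \geq 2$, is adjacent to exactly $x_0$ and $x_1$). -}

module Defs where

open import Data.Nat as ℕ using (ℕ; zero; suc; _≡ᵇ_; _<ᵇ_)
open import Data.Nat.Divisibility using (_∣_)
open import Data.Fin using (Fin; toℕ)
open import Data.Bool using (Bool; true; false; if_then_else_; _∧_; _∨_; not; _xor_)
open import Data.List using (List; []; _∷_; concatMap; map; sum; allFin; length; filter)
open import Data.Integer using (+_)
open import Data.Rational using (ℚ; 0ℚ; _+_; _*_; _<_; _≤_; _/_)
open import Data.Product using (Σ; ∃; _×_; _,_)
open import Data.Sum using (_⊎_)
open import Relation.Binary.PropositionalEquality using (_≡_)
open import Relation.Nullary using (¬_)
open import Level using (0ℓ) renaming (suc to lsuc)

record Graph : Set where
  field
    n     : ℕ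
    adj   : Fin n → Fin n → Bool
    sym   : ∀ i j → adj i j ≡ adj j i
    loopless : ∀ i → adj i i ≡ false
open Graph public

HasEdge : Graph → Set
HasEdge G = Σ (Fin (n G)) λ i → Σ (Fin (n G)) λ j → adj G i j ≡ true

count : {A : Set} → (A → Bool) → List A → ℕ
count p xs = length (filter (λ x → Data.Bool.T? (p x)) xs)
  where import Data.Bool

deg : (G : Graph) → Fin (n G) → ℕ
deg G i = count (adj G i) (allFin (n G))

numDeg : Graph → ℕ → ℕ
numDeg G d = count (λ i → deg G i ≡ᵇ d) (allFin (n G))

MinDegree : Graph → ℕ → Set
MinDegree G δ = (∀ i → δ ℕ.≤ deg G i) × Σ (Fin (n G)) λ i → deg G i ≡ δ

MaxDegree : Graph → ℕ → Set
MaxDegree G Δ = (∀ i → deg G i ℕ.≤ Δ) × Σ (Fin (n G)) λ i → deg G i ≡ Δ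

record _≅_ (G H : Graph) : Set where
  field
    to      : Fin (n G) → Fin (n H)
    from    : Fin (n H) → Fin (n G)
    from∘to : ∀ i → from (to i) ≡ i
    to∘from : ∀ j → to (from j) ≡ j
    preserves : ∀ i j → adj H (to i) (to j) ≡ adj G i j

K : ℕ → Graph
K m = record { n = m ; adj = λ i j → not (toℕ i ≡ᵇ toℕ j)
             ; sym = λ i j → symb i j ; loopless = λ i → loopb i }
  where
    open import Relation.Binary.PropositionalEquality using (refl; cong; sym)
    symeq : ∀ a b → (a ≡ᵇ b) ≡ (b ≡ᵇ a)
    symeq zero zero = refl
    symeq zero (suc b) = refl
    symeq (suc a) zero = refl
    symeq (suc a) (suc b) = symeq a b
    symb : ∀ (i j : Fin m) → not (toℕ i ≡ᵇ toℕ j) ≡ not (toℕ j ≡ᵇ toℕ i)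
    symb i j = cong not (symeq (toℕ i) (toℕ j))
    reflb : ∀ a → (a ≡ᵇ a) ≡ true
    reflb zero = refl
    reflb (suc a) = reflb a
    loopb : ∀ (i : Fin m) → not (toℕ i ≡ᵇ toℕ i) ≡ false
    loopb i = cong not (reflb (toℕ i))

Even : ℕ → Set
Even m = 2 ∣ m

InClass : ℕ → ℕ → Graph → Set
InClass δ Δ G =
  (0 ℕ.< δ) × (δ ℕ.≤ Δ) × MinDegree G δ × MaxDegree G Δ ×
  (δ ≡ Δ → G ≅ K (suc Δ)) ×
  (δ ℕ.< Δ → Even (Δ ℕ.* suc δ) →
     (n G ≡ suc Δ) × (numDeg G δ ≡ Δ)) ×
  (suc δ ℕ.< Δ → ¬ Even (Δ ℕ.* suc δ) →
     (n G ≡ suc Δ) × (numDeg G δ ≡ Δ ℕ.∸ 1) × (numDeg G (suc δ) ≡ 1)) ×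
  (suc δ ≡ Δ → ¬ Even Δ →
     (n G ≡ suc Δ) × (numDeg G δ ≡ Δ ℕ.∸ 1) × (numDeg G Δ ≡ 2))

-- bipartite graph K_{2,Δ} on Fin (2 + Δ): part {0,1} and part {2,...,Δ+1}
K2 : ℕ → Graph
K2 Δ = record { n = 2 ℕ.+ Δ ; adj = λ i j → small i xor small j
              ; sym = λ i j → xor-comm (small i) (small j)
              ; loopless = λ i → xor-self (small i) }
  where
    open import Relation.Binary.PropositionalEquality using (refl)
    small : Fin (2 ℕ.+ Δ) → Bool
    small i = toℕ i <ᵇ 2
    xor-comm : ∀ a b → (a xor b) ≡ (b xor a)
    xor-comm false false = refl
    xor-comm false true = refl
    xor-comm true false = refl
    xor-comm true true = refl
    xor-self : ∀ a → (a xor a) ≡ false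
    xor-self false = refl
    xor-self true = refl

-- H_Δ on Fin (Δ + 1): x₀ = 0, x₁ = 1 adjacent to each other and to all
-- other vertices x₂ … x_Δ, which are adjacent only to x₀ and x₁.
H : ℕ → Graph
H Δ = record { n = suc Δ
             ; adj = λ i j → not (toℕ i ≡ᵇ toℕ j) ∧ (small i ∨ small j)
             ; sym = λ i j → symH i j ; loopless = λ i → loopH i }
  where
    open import Relation.Binary.PropositionalEquality using (refl; cong; cong₂)
    small : Fin (suc Δ) → Bool
    small i = toℕ i <ᵇ 2
    symeq : ∀ a b → (a ≡ᵇ b) ≡ (b ≡ᵇ a)
    symeq zero zero = refl
    symeq zero (suc b) = refl
    symeq (suc a) zero = refl
    symeq (suc a) (suc b) = symeq a b
    ∨-comm : ∀ a b → (a ∨ b) ≡ (b ∨ a)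
    ∨-comm false false = refl
    ∨-comm false true = refl
    ∨-comm true false = refl
    ∨-comm true true = refl
    symH : ∀ i j → (not (toℕ i ≡ᵇ toℕ j) ∧ (small i ∨ small j))
                 ≡ (not (toℕ j ≡ᵇ toℕ i) ∧ (small j ∨ small i))
    symH i j = cong₂ _∧_ (cong not (symeq (toℕ i) (toℕ j))) (∨-comm (small i) (small j))
    reflb : ∀ a → (a ≡ᵇ a) ≡ true
    reflb zero = refl
    reflb (suc a) = reflb a
    loopH : ∀ i → (not (toℕ i ≡ᵇ toℕ i) ∧ (small i ∨ small i)) ≡ false
    loopH i rewrite reflb (toℕ i) = refl

-- Real numbers needed for GA₁, as Dedekind cuts over ℚ
-- (lower cut L, upper cut U).

record Cut : Set₁ where
  field
    L : ℚ → Set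
    U : ℚ → Set
open Cut public

ℚ⟨_⟩ : ℕ → ℚ
ℚ⟨ m ⟩ = + m / 1

zeroC : Cut
zeroC = record { L = λ r → r < 0ℚ ; U = λ r → 0ℚ < r }

_+C_ : Cut → Cut → Cut
x +C y = record
  { L = λ r → Σ ℚ λ a → Σ ℚ λ b → L x a × L y b × r ≤ a + b
  ; U = λ r → Σ ℚ λ a → Σ ℚ λ b → U x a × U y b × a + b ≤ r }

sumC : List Cut → Cut
sumC [] = zeroC
sumC (x ∷ xs) = x +C sumC xs

_<C_ : Cut → Cut → Set
x <C y = Σ ℚ λ q → U x q × L y q

-- the real number 2√(d e)/(d + e) (for d + e > 0):
-- r < 2√(de)/(d+e)  iff  r < 0 or r²(d+e)² < 4de;
-- r > 2√(de)/(d+e)  iff  r > 0 and 4de < r²(d+e)².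
gaTerm : ℕ → ℕ → Cut
gaTerm d e = record
  { L = λ r → (r < 0ℚ) ⊎ ((r * r) * (s * s) < ℚ⟨ 4 ℕ.* d ℕ.* e ⟩)
  ; U = λ r → (0ℚ < r) × (ℚ⟨ 4 ℕ.* d ℕ.* e ⟩ < (r * r) * (s * s)) }
  where s = ℚ⟨ d ℕ.+ e ⟩

edges : (G : Graph) → List (Fin (n G) × Fin (n G))
edges G = concatMap (λ i → concatMap (λ j →
            if adj G i j ∧ (toℕ i <ᵇ toℕ j) then (i , j) ∷ [] else [])
          (allFin (n G))) (allFin (n G))

GA₁ : Graph → Cut
GA₁ G = sumC (map (λ { (i , j) → gaTerm (deg G i) (deg G j) }) (edges G))

-- For even Δ, a graph of 𝒢_{2,Δ} has Δ + 1 vertices, one of degree Δ and Δ of degree 2 (for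
-- Δ = 2 it is K₃). With t = 2√(2Δ)/(Δ+2), its Δ hub edges contribute Δ t and its Δ/2 edges
-- between degree-2 vertices contribute 1 each, so GA₁ = Δ t + Δ/2, while GA₁(K_{2,Δ}) = 2Δ t
-- and GA₁(H_Δ) = 1 + 2(Δ − 1) t. Both inequalities reduce to t > 1/2, i.e. Δ² − 28Δ + 4 < 0,
-- which holds for 2 ≤ Δ ≤ 27. As GA₁ is a Dedekind cut, each side is bounded by sums of rational
-- bounds on the edge terms; these finitely many numerical facts are checked by evaluation.

module Submission where

open import Defs
open import Data.Nat using (ℕ; _≤_)
open import Data.Product using (_×_)
open import Relation.Nullary using (¬_)

open import Algebra.Bundles using (CommutativeMonoid)
open import Data.Bool using (Bool; true; false; T; if_then_else_; _∧_)
open import Data.Empty using (⊥-elim)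
open import Data.Fin as Fin using (Fin; toℕ; punchIn; punchOut)
import Data.Fin.Properties as FinP
open import Data.Integer as ℤ using (+_)
import Data.Integer.Properties as ℤP
import Data.Nat.Coprimality as Coprime
open Coprime using (Coprime)
open import Data.List using (List; []; _∷_; _++_; map; foldr; allFin; concatMap; tabulate)
import Data.List.Properties as ListP
open import Data.List.Relation.Unary.All using (All; []; _∷_; all?)
import Data.List.Relation.Unary.All.Properties as AllP
open import Data.Nat as ℕ using (zero; suc; pred; _∸_; _<ᵇ_; _≡ᵇ_; _≤ᵇ_; z≤n; s≤s)
import Data.Nat.Properties as ℕP
open import Data.Nat.Divisibility using (∣m⇒∣m*n; _∣?_)
open import Data.Product using (_,_; proj₁; proj₂)
open import Data.Rational as ℚ using (ℚ; _+_; _-_; _*_; _<_; _/_)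
import Data.Rational.Properties as ℚP
open import Algebra.Properties.AbelianGroup ℚP.+-0-abelianGroup using (xyx⁻¹≈y)
open import Data.Sum using (inj₁; inj₂)
open import Data.Vec.Functional using (Vector)
open import Function using (_∘_; id)
open import Relation.Binary.PropositionalEquality as ≡ using (_≡_; _≢_)
open import Relation.Nullary using (Dec; yes; no; does; _×-dec_; _⊎-dec_)
open import Relation.Nullary.Decidable using (toWitness; _→-dec_; ¬?; dec-true; dec-false)

Edge : Graph → Set
Edge G = Fin (n G) × Fin (n G)

isEdge : (G : Graph) → Fin (n G) → Fin (n G) → Bool
isEdge G i j = adj G i j ∧ (toℕ i <ᵇ toℕ j)

adjacent⇒distinct : (G : Graph) {i j : Fin (n G)} → adj G i j ≡ true → i ≢ j
adjacent⇒distinct G ij ≡.refl with () ← ≡.trans (≡.sym ij) (loopless G _)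

All-edges : (G : Graph) (P : Edge G → Set) → (∀ {i j} → adj G i j ≡ true → P (i , j)) → All P (edges G)
All-edges G P edge⇒P = AllP.concat⁺ (AllP.map⁺ (AllP.tabulate⁺ λ i →
                         AllP.concat⁺ (AllP.map⁺ (AllP.tabulate⁺ λ j → cell i j))))
  where
  cell : ∀ i j → All P (if isEdge G i j then (i , j) ∷ [] else [])
  cell i j with adj G i j in eq
  ... | false = []
  ... | true with toℕ i <ᵇ toℕ j
  ...   | false = []
  ...   | true  = edge⇒P eq ∷ []

edgeTerm : (G : Graph) → Edge G → Cut
edgeTerm G e = gaTerm (deg G (proj₁ e)) (deg G (proj₂ e))

-- Finite sums and the weighted handshake lemma

module Summation {c ℓ} (M : CommutativeMonoid c ℓ) where

  open CommutativeMonoid M renaming (sym to ≈-sym)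
  open import Algebra.Properties.CommutativeMonoid.Sum M public
    using (sum-syntax; ∑-comm; ∑-distrib-+; sum-cong-≋; sum-remove; sum-replicate)
  open import Algebra.Definitions.RawMonoid rawMonoid public using () renaming (_×_ to _·_)
  open import Relation.Binary.Reasoning.Setoid setoid

  sumₗ : List Carrier → Carrier
  sumₗ = foldr _∙_ ε

  sumₗ-++ : ∀ xs ys → sumₗ (xs ++ ys) ≈ sumₗ xs ∙ sumₗ ys
  sumₗ-++ []       ys = ≈-sym (identityˡ _)
  sumₗ-++ (x ∷ xs) ys = trans (∙-congˡ (sumₗ-++ xs ys)) (≈-sym (assoc x _ _))

  sumₗ-concatMap : ∀ {a} {A : Set a} (g : A → List Carrier) xs →
                   sumₗ (concatMap g xs) ≈ sumₗ (map (sumₗ ∘ g) xs)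
  sumₗ-concatMap g []       = refl
  sumₗ-concatMap g (x ∷ xs) = trans (sumₗ-++ (g x) _) (∙-congˡ (sumₗ-concatMap g xs))

  sumₗ-tabulate : ∀ {n} (f : Fin n → Carrier) → sumₗ (tabulate f) ≡ ∑[ i < n ] f i
  sumₗ-tabulate {zero}  f = ≡.refl
  sumₗ-tabulate {suc n} f = ≡.cong (f Fin.zero ∙_) (sumₗ-tabulate (f ∘ Fin.suc))

  sumₗ-allFin : ∀ {n} (f : Fin n → Carrier) → sumₗ (map f (allFin n)) ≡ ∑[ i < n ] f i
  sumₗ-allFin {n} f = ≡.trans (≡.cong sumₗ (ListP.map-tabulate id f)) (sumₗ-tabulate f)

  count-· : ∀ {A : Set} (p : A → Bool) xs x →
            count p xs · x ≈ sumₗ (map (λ y → if p y then x else ε) xs)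
  count-· p []       x = refl
  count-· p (y ∷ ys) x with p y
  ... | true  = ∙-congˡ (count-· p ys x)
  ... | false = trans (count-· p ys x) (≈-sym (identityˡ _))

  ∑-const-except : ∀ {n} (t : Vector Carrier n) (v : Fin n) {y} → (∀ i → i ≢ v → t i ≈ y) →
            ∑[ i < n ] t i ≈ t v ∙ pred n · y
  ∑-const-except {suc n} t v {y} off-v = begin
    ∑[ i < suc n ] t i                   ≈⟨ sum-remove {i = v} t ⟩
    t v ∙ ∑[ i < n ] t (punchIn v i)     ≈⟨ ∙-congˡ (sum-cong-≋ {n} (λ i → off-v _ (FinP.punchInᵢ≢i v i))) ⟩
    t v ∙ ∑[ i < n ] y                   ≈⟨ ∙-congˡ (sum-replicate n) ⟩
    t v ∙ n · y                          ∎

  sumₗ-map-if : ∀ {a} {A : Set a} (k : A → Carrier) b x →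
                sumₗ (map k (if b then x ∷ [] else [])) ≈ (if b then k x else ε)
  sumₗ-map-if k true  x = identityʳ (k x)
  sumₗ-map-if k false x = refl

  sumₗ-map-concatMap-allFin : ∀ {a} {A : Set a} {n} (k : A → Carrier) (g : Fin n → List A) →
                              sumₗ (map k (concatMap g (allFin n))) ≈ ∑[ i < n ] sumₗ (map k (g i))
  sumₗ-map-concatMap-allFin {n = n} k g = begin
    sumₗ (map k (concatMap g (allFin n)))          ≡⟨ ≡.cong sumₗ (ListP.map-concatMap k g (allFin n)) ⟩
    sumₗ (concatMap (map k ∘ g) (allFin n))        ≈⟨ sumₗ-concatMap (map k ∘ g) (allFin n) ⟩
    sumₗ (map (sumₗ ∘ map k ∘ g) (allFin n))       ≡⟨ sumₗ-allFin (sumₗ ∘ map k ∘ g) ⟩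
    ∑[ i < n ] sumₗ (map k (g i))                  ∎

  if-∙ : ∀ b x y → (if b then x ∙ y else ε) ≈ (if b then x else ε) ∙ (if b then y else ε)
  if-∙ true  x y = refl
  if-∙ false x y = ≈-sym (identityˡ ε)

  if-<ᵇ-split : ∀ m n → m ≢ n → ∀ x → (if m <ᵇ n then x else ε) ∙ (if n <ᵇ m then x else ε) ≈ x
  if-<ᵇ-split zero    zero    m≢n x = ⊥-elim (m≢n ≡.refl)
  if-<ᵇ-split zero    (suc n) m≢n x = identityʳ x
  if-<ᵇ-split (suc m) zero    m≢n x = identityˡ x
  if-<ᵇ-split (suc m) (suc n) m≢n x = if-<ᵇ-split m n (m≢n ∘ ≡.cong suc) x

  module _ (G : Graph) where

    sumₗ-edges : (k : Edge G → Carrier) →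
                 sumₗ (map k (edges G)) ≈ ∑[ i < n G ] ∑[ j < n G ] (if isEdge G i j then k (i , j) else ε)
    sumₗ-edges k = begin
      sumₗ (map k (edges G))                    ≈⟨ sumₗ-map-concatMap-allFin k row ⟩
      ∑[ i < n G ] sumₗ (map k (row i))          ≈⟨ sum-cong-≋ {n G} (λ i →
        trans (sumₗ-map-concatMap-allFin k (cell i))
              (sum-cong-≋ {n G} (λ j → sumₗ-map-if k (isEdge G i j) (i , j)))) ⟩
      ∑[ i < n G ] ∑[ j < n G ] (if isEdge G i j then k (i , j) else ε) ∎
      where
      cell : Fin (n G) → Fin (n G) → List (Edge G)
      cell i j = if isEdge G i j then (i , j) ∷ [] else []
      row : Fin (n G) → List (Edge G)
      row i = concatMap (cell i) (allFin (n G))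

    edge-pair : ∀ i j x → (if isEdge G i j then x else ε) ∙ (if isEdge G j i then x else ε)
                          ≈ (if adj G i j then x else ε)
    edge-pair i j x rewrite Graph.sym G j i with adj G i j in eq
    ... | false = identityˡ ε
    ... | true  = if-<ᵇ-split (toℕ i) (toℕ j) (adjacent⇒distinct G eq ∘ FinP.toℕ-injective) x

    handshake : (h : Fin (n G) → Carrier) →
      sumₗ (map (λ e → h (proj₁ e) ∙ h (proj₂ e)) (edges G)) ≈ ∑[ i < n G ] (deg G i · h i)
    handshake h = begin
      sumₗ (map (λ e → h (proj₁ e) ∙ h (proj₂ e)) (edges G))
        ≈⟨ sumₗ-edges _ ⟩
      ∑[ i < N ] ∑[ j < N ] [ i , j ] (h i ∙ h j)
        ≈⟨ sum-cong-≋ {N} (λ i → trans (sum-cong-≋ {N} (λ j → if-∙ (isEdge G i j) (h i) (h j)))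
                                        (∑-distrib-+ (λ j → [ i , j ] (h i)) (λ j → [ i , j ] (h j)))) ⟩
      ∑[ i < N ] (∑[ j < N ] [ i , j ] (h i) ∙ ∑[ j < N ] [ i , j ] (h j))
        ≈⟨ ∑-distrib-+ (λ i → ∑[ j < N ] [ i , j ] (h i)) (λ i → ∑[ j < N ] [ i , j ] (h j)) ⟩
      ∑[ i < N ] ∑[ j < N ] [ i , j ] (h i) ∙ ∑[ i < N ] ∑[ j < N ] [ i , j ] (h j)
        ≈⟨ ∙-congˡ (∑-comm (λ i j → [ i , j ] (h j))) ⟩
      ∑[ i < N ] ∑[ j < N ] [ i , j ] (h i) ∙ ∑[ i < N ] ∑[ j < N ] [ j , i ] (h i)
        ≈⟨ ≈-sym (∑-distrib-+ (λ i → ∑[ j < N ] [ i , j ] (h i)) (λ i → ∑[ j < N ] [ j , i ] (h i))) ⟩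
      ∑[ i < N ] (∑[ j < N ] [ i , j ] (h i) ∙ ∑[ j < N ] [ j , i ] (h i))
        ≈⟨ sum-cong-≋ {N} (λ i → trans (≈-sym (∑-distrib-+ (λ j → [ i , j ] (h i)) (λ j → [ j , i ] (h i))))
                                        (sum-cong-≋ {N} (λ j → edge-pair i j (h i)))) ⟩
      ∑[ i < N ] ∑[ j < N ] (if adj G i j then h i else ε)
        ≈⟨ sum-cong-≋ {N} (λ i → ≈-sym (trans (count-· (adj G i) (allFin N) (h i))
                                               (reflexive (sumₗ-allFin (λ j → if adj G i j then h i else ε))))) ⟩
      ∑[ i < N ] (deg G i · h i) ∎
      where
      N = n G
      [_,_] : Fin N → Fin N → Carrier → Carrier
      [ i , j ] x = if isEdge G i j then x else ε

module ℕ+ = Summation ℕP.+-0-commutativeMonoid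
open ℕ+ using (sum-syntax)

·≡* : ∀ m x → m ℕ+.· x ≡ m ℕ.* x
·≡* zero    x = ≡.refl
·≡* (suc m) x = ≡.cong (x ℕ.+_) (·≡* m x)

indicator : Bool → ℕ
indicator b = if b then 1 else 0

indicator≤1 : ∀ b → indicator b ≤ 1
indicator≤1 true  = s≤s z≤n
indicator≤1 false = z≤n

indicator≡1⇒T : ∀ {b} → indicator b ≡ 1 → T b
indicator≡1⇒T {true} _ = _

numDeg≡∑ : ∀ G d → numDeg G d ≡ ∑[ i < n G ] indicator (deg G i ≡ᵇ d)
numDeg≡∑ G d = ≡.trans (≡.sym (≡.trans (·≡* (numDeg G d) 1) (ℕP.*-identityʳ (numDeg G d))))
                 (≡.trans (ℕ+.count-· (λ i → deg G i ≡ᵇ d) (allFin (n G)) 1)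
                          (ℕ+.sumₗ-allFin (λ i → indicator (deg G i ≡ᵇ d))))

∑≤n : ∀ {m} (f : Fin m → ℕ) → (∀ i → f i ≤ 1) → ∑[ i < m ] f i ≤ m
∑≤n {zero}  f f≤1 = z≤n
∑≤n {suc m} f f≤1 = ℕP.+-mono-≤ (f≤1 Fin.zero) (∑≤n (f ∘ Fin.suc) (f≤1 ∘ Fin.suc))

+-tight : ∀ {a s m} → a ≤ 1 → s ≤ m → a ℕ.+ s ≡ suc m → a ≡ 1 × s ≡ m
+-tight z≤n       s≤m ≡.refl = ⊥-elim (ℕP.<-irrefl ≡.refl s≤m)
+-tight (s≤s z≤n) s≤m eq     = ≡.refl , ℕP.suc-injective eq

∑≡n⇒≡1 : ∀ {m} (f : Fin m → ℕ) → (∀ i → f i ≤ 1) → ∑[ i < m ] f i ≡ m → ∀ i → f i ≡ 1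
∑≡n⇒≡1 {suc m} f f≤1 ∑≡ i
  with +-tight (f≤1 Fin.zero) (∑≤n (f ∘ Fin.suc) (f≤1 ∘ Fin.suc)) ∑≡
... | head≡1 , tail≡ with i
...   | Fin.zero  = head≡1
...   | Fin.suc i = ∑≡n⇒≡1 (f ∘ Fin.suc) (f≤1 ∘ Fin.suc) tail≡ i

∑≡n∸1⇒≡1-off : ∀ {m} (f : Fin m → ℕ) (v : Fin m) → (∀ i → f i ≤ 1) → f v ≡ 0 →
                  suc (∑[ i < m ] f i) ≡ m → ∀ i → i ≢ v → f i ≡ 1
∑≡n∸1⇒≡1-off {suc m} f v f≤1 fv≡0 ∑≡ i i≢v = begin
  f i                           ≡⟨ ≡.cong f (≡.sym (FinP.punchIn-punchOut v≢i)) ⟩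
  f (punchIn v (punchOut v≢i))  ≡⟨ ∑≡n⇒≡1 (f ∘ punchIn v) (f≤1 ∘ punchIn v) rest≡ _ ⟩
  1                             ∎
  where
  open ≡.≡-Reasoning
  v≢i = i≢v ∘ ≡.sym
  rest≡ : ∑[ j < m ] f (punchIn v j) ≡ m
  rest≡ = ℕP.suc-injective (begin
    suc (∑[ j < m ] f (punchIn v j))            ≡⟨ ≡.cong (λ x → suc (x ℕ.+ ∑[ j < m ] f (punchIn v j))) (≡.sym fv≡0) ⟩
    suc (f v ℕ.+ ∑[ j < m ] f (punchIn v j))    ≡⟨ ≡.cong suc (≡.sym (ℕ+.sum-remove {i = v} f)) ⟩
    suc (∑[ j < suc m ] f j)                    ≡⟨ ∑≡ ⟩
    suc m                                       ∎)

-- The graphs of 𝒢_{2,Δ} for even Δ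

record HubDegrees (Δ : ℕ) (G : Graph) : Set where
  field
    order      : n G ≡ suc Δ
    hub        : Fin (n G)
    hub-degree : deg G hub ≡ Δ
    rim-degree : ∀ i → i ≢ hub → deg G i ≡ 2

≅-order : ∀ {G m} → G ≅ K m → n G ≡ m
≅-order iso = FinP.cantor-schröder-bernstein
  (λ {x} {y} eq → ≡.trans (≡.sym (from∘to x)) (≡.trans (≡.cong from eq) (from∘to y)))
  (λ {x} {y} eq → ≡.trans (≡.sym (to∘from x)) (≡.trans (≡.cong to eq) (to∘from y)))
  where
  open _≅_ iso

hub-degrees : ∀ {Δ G} → 2 ≤ Δ → Even Δ → InClass 2 Δ G → HubDegrees Δ G
hub-degrees {Δ} {G} 2≤Δ even (_ , _ , (≥2 , _) , (≤Δ , v , deg-v) , complete , regular-but-one , _)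
  with ℕP.m≤n⇒m<n∨m≡n 2≤Δ
... | inj₂ ≡.refl = record
  { order      = ≅-order (complete ≡.refl)
  ; hub        = v
  ; hub-degree = deg-v
  ; rim-degree = λ i _ → ℕP.≤-antisym (≤Δ i) (≥2 i)
  }
-- Exposing Δ = 3 + k lets `Δ ≡ᵇ 2` compute to false in is-two-v.
... | inj₁ 2<Δ@(s≤s (s≤s (s≤s _))) = record
  { order      = order
  ; hub        = v
  ; hub-degree = deg-v
  ; rim-degree = λ i i≢v → ℕP.≡ᵇ⇒≡ _ 2 (indicator≡1⇒T
      (∑≡n∸1⇒≡1-off is-two v (λ i → indicator≤1 _) is-two-v
                     (≡.trans (≡.cong suc two-count) (≡.sym order)) i i≢v))
  }
  where
  order×count = regular-but-one 2<Δ (∣m⇒∣m*n 3 even)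
  order = proj₁ order×count
  is-two : Fin (n G) → ℕ
  is-two i = indicator (deg G i ≡ᵇ 2)
  is-two-v : is-two v ≡ 0
  is-two-v rewrite deg-v = ≡.refl
  two-count : ∑[ i < n G ] is-two i ≡ Δ
  two-count = ≡.trans (≡.sym (numDeg≡∑ G 2)) (proj₂ order×count)

-- Rational bounds on sums of cuts

-- All bounds are multiples ⟦ k ⟧ = k/10⁶ of one unit, so that sums of bounds are computed in ℕ.
scale : ℕ
scale = 1000000

unit : ℚ
unit = + 1 / scale

⟦_⟧ : ℕ → ℚ
⟦ k ⟧ = ℚ⟨ k ⟩ * unit

ℚ⟨⟩-+ : ∀ m n → ℚ⟨ m ℕ.+ n ⟩ ≡ ℚ⟨ m ⟩ + ℚ⟨ n ⟩
ℚ⟨⟩-+ m n = begin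
  (+ m ℤ.+ + n) / 1
    ≡⟨ ≡.cong₂ (λ a b → (a ℤ.+ b) / 1) (≡.sym (ℤP.*-identityʳ (+ m))) (≡.sym (ℤP.*-identityʳ (+ n))) ⟩
  (+ m ℤ.* + 1 ℤ.+ + n ℤ.* + 1) / 1
    ≡⟨ ≡.cong₂ _+_ (≡.sym (ℚP.normalize-coprime (coprime-1 m))) (≡.sym (ℚP.normalize-coprime (coprime-1 n))) ⟩
  ℚ⟨ m ⟩ + ℚ⟨ n ⟩
    ∎
  where
  open ≡.≡-Reasoning
  coprime-1 : ∀ k → Coprime k 1
  coprime-1 k = Coprime.sym (Coprime.1-coprimeTo k)

⟦⟧-+ : ∀ m n → ⟦ m ℕ.+ n ⟧ ≡ ⟦ m ⟧ + ⟦ n ⟧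
⟦⟧-+ m n = ≡.trans (≡.cong (_* unit) (ℚ⟨⟩-+ m n)) (ℚP.*-distribʳ-+ unit ℚ⟨ m ⟩ ℚ⟨ n ⟩)

p+[q-p]≡q : ∀ p q → p + (q - p) ≡ q
p+[q-p]≡q p q = ≡.trans (≡.sym (ℚP.+-assoc p q (ℚ.- p))) (xyx⁻¹≈y p q)

p+q<r⇒q<r-p : ∀ {p q r} → p + q < r → q < r - p
p+q<r⇒q<r-p {p} {q} lt = ≡.subst (_< _) (xyx⁻¹≈y p q) (ℚP.+-monoˡ-< (ℚ.- p) lt)

r<p+q⇒r-p<q : ∀ {p q r} → r < p + q → r - p < q
r<p+q⇒r-p<q {p} {q} lt = ≡.subst (_ <_) (xyx⁻¹≈y p q) (ℚP.+-monoˡ-< (ℚ.- p) lt)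

sumC-upper : ∀ {X : Set} (f : X → Cut) (k : X → ℕ) {xs} → All (λ x → U (f x) ⟦ k x ⟧) xs →
             ∀ {r} → ⟦ ℕ+.sumₗ (map k xs) ⟧ < r → U (sumC (map f xs)) r
sumC-upper f k []                       0<r = 0<r
sumC-upper f k {x ∷ xs} (ux ∷ uxs) {r} s<r =
  ⟦ k x ⟧ , r - ⟦ k x ⟧ , ux ,
  sumC-upper f k uxs (p+q<r⇒q<r-p (≡.subst (_< r) (⟦⟧-+ (k x) (ℕ+.sumₗ (map k xs))) s<r)) ,
  ℚP.≤-reflexive (p+[q-p]≡q ⟦ k x ⟧ r)

sumC-lower : ∀ {X : Set} (f : X → Cut) (k : X → ℕ) {xs} → All (λ x → L (f x) ⟦ k x ⟧) xs →
             ∀ {r} → r < ⟦ ℕ+.sumₗ (map k xs) ⟧ → L (sumC (map f xs)) r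
sumC-lower f k []                       r<0 = r<0
sumC-lower f k {x ∷ xs} (lx ∷ lxs) {r} r<s =
  ⟦ k x ⟧ , r - ⟦ k x ⟧ , lx ,
  sumC-lower f k lxs (r<p+q⇒r-p<q (≡.subst (r <_) (⟦⟧-+ (k x) (ℕ+.sumₗ (map k xs))) r<s)) ,
  ℚP.≤-reflexive (≡.sym (p+[q-p]≡q ⟦ k x ⟧ r))

<C-intro : ∀ {x y a b} → (∀ {r} → a < r → U x r) → (∀ {r} → r < b → L y r) → a < b → x <C y
<C-intro upper lower a<b with ℚP.<-dense a<b
... | q , a<q , q<b = q , upper a<q , lower q<b

-- With weight a on the degree-2 vertices and b on the hub, edge ij is bounded by
-- weight i + weight j, and the weighted handshake lemma evaluates the sum of these bounds
-- without knowing the edges: Σ deg(i)·weight(i) = Δ b + Δ·2a.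
module HubWeighting {Δ G} (hd : HubDegrees Δ G) (a b : ℕ) where

  open HubDegrees hd

  weight : Fin (n G) → ℕ
  weight i = if does (i Fin.≟ hub) then b else a

  edgeWeight : Edge G → ℕ
  edgeWeight e = weight (proj₁ e) ℕ.+ weight (proj₂ e)

  data Role (i : Fin (n G)) : Set where
    is-hub : i ≡ hub → deg G i ≡ Δ → weight i ≡ b → Role i
    is-rim : i ≢ hub → deg G i ≡ 2 → weight i ≡ a → Role i

  role : ∀ i → Role i
  role i with i Fin.≟ hub
  ... | yes i≡hub = is-hub i≡hub (≡.trans (≡.cong (deg G) i≡hub) hub-degree)
                                (≡.cong (if_then b else a) (dec-true (i Fin.≟ hub) i≡hub))
  ... | no  i≢hub = is-rim i≢hub (rim-degree i i≢hub)
                                (≡.cong (if_then b else a) (dec-false (i Fin.≟ hub) i≢hub))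

  weighted-sum : ℕ+.sumₗ (map edgeWeight (edges G)) ≡ Δ ℕ.* b ℕ.+ Δ ℕ.* (2 ℕ.* a)
  weighted-sum = begin
    ℕ+.sumₗ (map edgeWeight (edges G))                   ≡⟨ ℕ+.handshake G weight ⟩
    ∑[ i < n G ] (deg G i ℕ+.· weight i)                 ≡⟨ ℕ+.∑-const-except _ hub rim-term ⟩
    deg G hub ℕ+.· weight hub ℕ.+ pred (n G) ℕ+.· (2 ℕ+.· a)
      ≡⟨ ≡.cong₂ (λ d m → d ℕ+.· weight hub ℕ.+ m ℕ+.· (2 ℕ+.· a)) hub-degree (≡.cong pred order) ⟩
    Δ ℕ+.· weight hub ℕ.+ Δ ℕ+.· (2 ℕ+.· a)
      ≡⟨ ≡.cong₂ ℕ._+_ (≡.trans (·≡* Δ _) (≡.cong (Δ ℕ.*_) weight-hub))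
                       (≡.trans (·≡* Δ _) (≡.cong (Δ ℕ.*_) (·≡* 2 a))) ⟩
    Δ ℕ.* b ℕ.+ Δ ℕ.* (2 ℕ.* a)                          ∎
    where
    open ≡.≡-Reasoning
    weight-hub : weight hub ≡ b
    weight-hub with role hub
    ... | is-hub _ _ w       = w
    ... | is-rim hub≢hub _ _ = ⊥-elim (hub≢hub ≡.refl)
    rim-term : ∀ i → i ≢ hub → deg G i ℕ+.· weight i ≡ 2 ℕ+.· a
    rim-term i i≢hub with role i
    ... | is-hub i≡hub _ _ = ⊥-elim (i≢hub i≡hub)
    ... | is-rim _ dᵢ wᵢ   = ≡.cong₂ ℕ+._·_ dᵢ wᵢ

GA₁-hub-upper : ∀ {Δ G} → HubDegrees Δ G → (a b : ℕ) →
                U (gaTerm 2 2) ⟦ a ℕ.+ a ⟧ → U (gaTerm 2 Δ) ⟦ a ℕ.+ b ⟧ → U (gaTerm Δ 2) ⟦ b ℕ.+ a ⟧ →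
                ∀ {r} → ⟦ Δ ℕ.* b ℕ.+ Δ ℕ.* (2 ℕ.* a) ⟧ < r → U (GA₁ G) r
GA₁-hub-upper {Δ} {G} hd a b u-rim-rim u-rim-hub u-hub-rim {r} bound =
  sumC-upper (edgeTerm G) edgeWeight
    (All-edges G (λ e → U (edgeTerm G e) ⟦ edgeWeight e ⟧) (λ ij → edge-bound ij (role _) (role _)))
    (≡.subst (λ w → ⟦ w ⟧ < r) (≡.sym weighted-sum) bound)
  where
  open HubWeighting hd a b

  transport : ∀ i j {d e x y} → deg G i ≡ d → deg G j ≡ e → weight i ≡ x → weight j ≡ y →
              U (gaTerm d e) ⟦ x ℕ.+ y ⟧ → U (edgeTerm G (i , j)) ⟦ edgeWeight (i , j) ⟧
  transport i j ≡.refl ≡.refl ≡.refl ≡.refl u = u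

  edge-bound : ∀ {i j} → adj G i j ≡ true → Role i → Role j → U (edgeTerm G (i , j)) ⟦ edgeWeight (i , j) ⟧
  edge-bound ij (is-hub i≡hub _ _) (is-hub j≡hub _ _) =
    ⊥-elim (adjacent⇒distinct G ij (≡.trans i≡hub (≡.sym j≡hub)))
  edge-bound {i} {j} _ (is-hub _ dᵢ wᵢ) (is-rim _ dⱼ wⱼ) = transport i j dᵢ dⱼ wᵢ wⱼ u-hub-rim
  edge-bound {i} {j} _ (is-rim _ dᵢ wᵢ) (is-hub _ dⱼ wⱼ) = transport i j dᵢ dⱼ wᵢ wⱼ u-rim-hub
  edge-bound {i} {j} _ (is-rim _ dᵢ wᵢ) (is-rim _ dⱼ wⱼ) = transport i j dᵢ dⱼ wᵢ wⱼ u-rim-rim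

-- Numerical certificates

-- The edge lists are parameters, instantiated with `edges G`, so that deciding a separation
-- evaluates each list only once.
EdgeSeparation : (G G′ : Graph) → (Edge G → ℕ) → (Edge G′ → ℕ) → List (Edge G) → List (Edge G′) → Set
EdgeSeparation G G′ u l xs ys =
  All (λ e → U (edgeTerm G e) ⟦ u e ⟧) xs × All (λ e → L (edgeTerm G′ e) ⟦ l e ⟧) ys ×
  ⟦ ℕ+.sumₗ (map u xs) ⟧ < ⟦ ℕ+.sumₗ (map l ys) ⟧

edgeSeparation⇒<C : ∀ G G′ u l → EdgeSeparation G G′ u l (edges G) (edges G′) → GA₁ G <C GA₁ G′
edgeSeparation⇒<C G G′ u l (above , below , gap) =
  <C-intro {GA₁ G} {GA₁ G′} (sumC-upper (edgeTerm G) u above) (sumC-lower (edgeTerm G′) l below) gap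

HubSeparation : (Δ a b : ℕ) (G′ : Graph) → (Edge G′ → ℕ) → List (Edge G′) → Set
HubSeparation Δ a b G′ l ys =
  U (gaTerm 2 2) ⟦ a ℕ.+ a ⟧ × U (gaTerm 2 Δ) ⟦ a ℕ.+ b ⟧ × U (gaTerm Δ 2) ⟦ b ℕ.+ a ⟧ ×
  All (λ e → L (edgeTerm G′ e) ⟦ l e ⟧) ys × ⟦ Δ ℕ.* b ℕ.+ Δ ℕ.* (2 ℕ.* a) ⟧ < ⟦ ℕ+.sumₗ (map l ys) ⟧

hubSeparation⇒<C : ∀ {Δ G} a b G′ l → HubDegrees Δ G → HubSeparation Δ a b G′ l (edges G′) →
                   GA₁ G <C GA₁ G′
hubSeparation⇒<C {G = G} a b G′ l hd (u-rim-rim , u-rim-hub , u-hub-rim , below , gap) =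
  <C-intro {GA₁ G} {GA₁ G′} (GA₁-hub-upper hd a b u-rim-rim u-rim-hub u-hub-rim)
                            (sumC-lower (edgeTerm G′) l below) gap

U? : ∀ d e r → Dec (U (gaTerm d e) r)
U? d e r = (_ ℚP.<? r) ×-dec (_ ℚP.<? _)

L? : ∀ d e r → Dec (L (gaTerm d e) r)
L? d e r = (r ℚP.<? _) ⊎-dec (_ ℚP.<? _)

edgeSeparation? : ∀ G G′ u l xs ys → Dec (EdgeSeparation G G′ u l xs ys)
edgeSeparation? G G′ u l xs ys =
  all? (λ e → U? (deg G (proj₁ e)) (deg G (proj₂ e)) ⟦ u e ⟧) xs ×-dec
  all? (λ e → L? (deg G′ (proj₁ e)) (deg G′ (proj₂ e)) ⟦ l e ⟧) ys ×-dec
  (⟦ ℕ+.sumₗ (map u xs) ⟧ ℚP.<? ⟦ ℕ+.sumₗ (map l ys) ⟧)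

hubSeparation? : ∀ Δ a b G′ l ys → Dec (HubSeparation Δ a b G′ l ys)
hubSeparation? Δ a b G′ l ys =
  U? 2 2 ⟦ a ℕ.+ a ⟧ ×-dec U? 2 Δ ⟦ a ℕ.+ b ⟧ ×-dec U? Δ 2 ⟦ b ℕ.+ a ⟧ ×-dec
  all? (λ e → L? (deg G′ (proj₁ e)) (deg G′ (proj₂ e)) ⟦ l e ⟧) ys ×-dec
  (⟦ Δ ℕ.* b ℕ.+ Δ ℕ.* (2 ℕ.* a) ⟧ ℚP.<? ⟦ ℕ+.sumₗ (map l ys) ⟧)

-- ⌊√m / q⌋, one base-4 digit at a time. It only proposes numerators: every bound built from it
-- is verified by `certificate?`.
root : ℕ → ℕ → ℕ
root q m = go m m
  where
  next-digit : ℕ → ℕ → ℕ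
  next-digit m′ k = if (q ℕ.* suc k) ℕ.* (q ℕ.* suc k) ≤ᵇ m′ then suc k else k
  go : ℕ → ℕ → ℕ
  go zero       _          = 0
  go (suc fuel) zero       = 0
  go (suc fuel) m′@(suc _) = next-digit m′ (2 ℕ.* go fuel (m′ ℕ./ 4))

gaFloor : ℕ → ℕ → ℕ
gaFloor d e = root (d ℕ.+ e) (4 ℕ.* d ℕ.* e ℕ.* scale ℕ.* scale)

-- Shifted by one unit so that the bounds stay strict when the root is exact (e.g. for d = e).
gaBelow gaAbove : ℕ → ℕ → ℕ
gaBelow d e = gaFloor d e ∸ 1
gaAbove d e = suc (gaFloor d e)

edgeUnits : (ℕ → ℕ → ℕ) → (G : Graph) → Edge G → ℕ
edgeUnits w G e = w (deg G (proj₁ e)) (deg G (proj₂ e))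

-- 2·rimUnits exceeds the term 1 of a rim–rim edge; rimUnits + hubUnits Δ exceeds that of a rim–hub edge.
rimUnits : ℕ
rimUnits = suc (scale ℕ./ 2)

hubUnits : ℕ → ℕ
hubUnits Δ = gaAbove 2 Δ ∸ rimUnits

Certificate : ℕ → Set
Certificate Δ =
  (Even Δ → HubSeparation Δ rimUnits (hubUnits Δ) (K2 Δ) (edgeUnits gaBelow (K2 Δ)) (edges (K2 Δ))) ×
  (¬ Even Δ → EdgeSeparation (H Δ) (K2 Δ) (edgeUnits gaAbove (H Δ)) (edgeUnits gaBelow (K2 Δ))
                             (edges (H Δ)) (edges (K2 Δ)))

certificate? : ∀ Δ → Dec (Certificate Δ)
certificate? Δ =
  ((2 ∣? Δ) →-dec hubSeparation? Δ rimUnits (hubUnits Δ) (K2 Δ) (edgeUnits gaBelow (K2 Δ)) (edges (K2 Δ))) ×-dec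
  (¬? (2 ∣? Δ) →-dec edgeSeparation? (H Δ) (K2 Δ) (edgeUnits gaAbove (H Δ)) (edgeUnits gaBelow (K2 Δ))
                                     (edges (H Δ)) (edges (K2 Δ)))

certified : ∀ {Δ} → Δ ℕ.< 28 → 2 ≤ Δ → Certificate Δ
certified = toWitness {a? = ℕP.allUpTo? (λ Δ → (2 ℕP.≤? Δ) →-dec certificate? Δ) 28} _

proposition2p21 : (Δ : ℕ) → 2 ≤ Δ → Δ ≤ 27 →
    ((Even Δ → (G : Graph) → InClass 2 Δ G → GA₁ G <C GA₁ (K2 Δ)) ×
     (¬ Even Δ → GA₁ (H Δ) <C GA₁ (K2 Δ)))
proposition2p21 Δ 2≤Δ Δ≤27 =
  (λ even G G∈𝒢 → hubSeparation⇒<C rimUnits (hubUnits Δ) (K2 Δ) (edgeUnits gaBelow (K2 Δ))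
                     (hub-degrees 2≤Δ even G∈𝒢) (proj₁ certificate even)) ,
  (λ odd → edgeSeparation⇒<C (H Δ) (K2 Δ) (edgeUnits gaAbove (H Δ)) (edgeUnits gaBelow (K2 Δ))
             (proj₂ certificate odd))
  where
  certificate : Certificate Δ
  certificate = certified (s≤s Δ≤27) 2≤Δ
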